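{- For any graph $G=(V,E)$ on $|V|=n$ vertices, any independent set $I$ in $G$, and any integer $t\ge 1$, the $t$-th container $C_t$ of $I$ satisfies $\Delta(G[C_t])\le n/t$, where $\Delta$ denotes maximum degree.
   Context: Fingerprints and containers are defined by the following greedy procedure, run on a graph $G=(V,E)$ and an independent set $I\subseteq V$ (ties in "largest degree" broken by a fixed rule). Set $F_0=\emptyset$, $C_0=V$. For $t=1,2,\dots,|I|$: let $v_t$ be the vertex of $I\setminus F_{t-1}$ with largest degree in the induced subgraph $G[C_{t-1}]$; set $F_t=F_{t-1}\cup\{v_t\}$; set $C_t$ to be $C_{t-1}$ with all neighbours of $v_t$ removed and also with all vertices $w\in C_{t-1}$ with $\deg_{G[C_{t-1}]}(w)>\deg_{G[C_{t-1}]}(v_t)$ removed. For $t>|I|$ set $F_t=C_t=I$. $C_t$ is the $t$-th container of $I$. -}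

module Defs where

open import Data.Nat using (ℕ; zero; suc; _<ᵇ_; _⊔_)
open import Data.Bool using (Bool; true; false; _∧_; _∨_; not; if_then_else_)
open import Data.Fin using (Fin; _≟_)
open import Relation.Nullary.Decidable using (⌊_⌋)
open import Data.Maybe using (Maybe; just; nothing)
open import Data.List using (List; foldl; foldr; map; filterᵇ; length; allFin)
open import Data.Product using (_×_; _,_; proj₂)
open import Relation.Binary.PropositionalEquality using (_≡_)

record Graph (n : ℕ) : Set where
  field
    adj   : Fin n → Fin n → Bool
    sym   : ∀ u v → adj u v ≡ adj v u
    loopless : ∀ v → adj v v ≡ false
open Graph public

VSet : ℕ → Set
VSet n = Fin n → Bool

module _ {n : ℕ} (G : Graph n) where

  IsIndependent : VSet n → Set
  IsIndependent I = ∀ u v → I u ≡ true → I v ≡ true → adj G u v ≡ false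

  deg : VSet n → Fin n → ℕ
  deg C w = length (filterᵇ (λ u → C u ∧ adj G w u) (allFin n))

  maxDeg : VSet n → ℕ
  maxDeg C = foldr (λ w m → (if C w then deg C w else 0) ⊔ m) 0 (allFin n)

  argmax : VSet n → (Fin n → ℕ) → Maybe (Fin n)
  argmax cand d = foldl step nothing (allFin n)
    where
    step : Maybe (Fin n) → Fin n → Maybe (Fin n)
    step acc v with cand v
    ... | false = acc
    ... | true with acc
    ...   | nothing = just v
    ...   | just u = if d u <ᵇ d v then just v else just u

  -- one step of the greedy procedure, from (F_{t-1}, C_{t-1}) to (F_t, C_t).
  -- If I \ F_{t-1} is empty (which happens exactly when t > |I|) we set F_t = C_t = I.
  step : VSet n → VSet n × VSet n → VSet n × VSet n
  step I (F , C) with argmax (λ v → I v ∧ not (F v)) (deg C)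
  ... | nothing = I , I
  ... | just v =
        (λ w → F w ∨ ⌊ w ≟ v ⌋) ,
        (λ w → C w ∧ not (adj G v w) ∧ not (deg C v <ᵇ deg C w))

  run : VSet n → ℕ → VSet n × VSet n
  run I zero = (λ _ → false) , (λ _ → true)
  run I (suc t) = step I (run I t)

  container : VSet n → ℕ → VSet n
  container I t = proj₂ (run I t)

{-# OPTIONS --safe #-}
-- Let Δ_s be the degree in G[C_{s-1}] of the vertex v_s picked at step s.
-- Since v_s has maximum degree among the remaining vertices of I, and every
-- vertex of degree larger than Δ_s is dropped, all degrees in G[C_s] and all
-- candidate degrees are at most Δ_s; hence Δ_1 ≥ Δ_2 ≥ ⋯ ≥ Δ(G[C_t]).
-- Step s also deletes the Δ_s neighbours of v_s in C_{s-1}, so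
-- t · Δ_t ≤ Δ_1 + ⋯ + Δ_t ≤ n − |C_t|.  Once I is exhausted, C_t = I spans
-- no edges.
module Submission where

open import Defs
open import Data.Nat using (ℕ; _≤_; _*_)
open import Data.Bool using (true)
open import Relation.Binary.PropositionalEquality using (_≡_)

open import Data.Nat using (zero; suc; _+_; _<ᵇ_; _⊔_; z≤n; s≤s)
open import Data.Nat.Properties
  using (≤-refl; ≤-trans; ≤-reflexive; <⇒≤; <ᵇ⇒<; <⇒<ᵇ; ≮⇒≥; m≤n⇒m≤1+n; m≤m+n; +-suc;
         *-zeroʳ; *-monoʳ-≤; +-mono-≤; ⊔-lub; module ≤-Reasoning)
open import Data.Nat.Tactic.RingSolver using (solve-∀)
open import Data.Bool using (Bool; false; _∧_; _∨_; not; if_then_else_; T)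
open import Data.Bool.Properties using (∧-conicalˡ; ∧-conicalʳ; ∧-identityʳ; ∧-zeroʳ; ∧-inverseʳ; not-involutive; T-≡)
open import Data.Fin using (Fin)
open import Data.Maybe using (Maybe; just; nothing; maybe′)
open import Data.Maybe.Relation.Unary.All using (All; just; nothing; drop-just)
open import Data.List using (List; []; _∷_; foldl; foldr; filterᵇ; length; allFin)
open import Data.List.Properties using (length-filter; length-tabulate)
open import Data.List.Relation.Unary.Any using (here; there)
open import Data.List.Membership.Propositional using (_∈_)
open import Data.List.Membership.Propositional.Properties using (∈-allFin)
open import Data.Product using (_×_; _,_; proj₁; proj₂)
open import Function using (_∘_; id)
open import Function.Bundles using (Equivalence)
open import Relation.Nullary using (contradiction)
open import Relation.Nullary.Decidable using (T?)
open import Relation.Binary.PropositionalEquality using (refl; trans; cong; cong₂; subst)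
import Relation.Binary.PropositionalEquality as ≡

_⊆ᵇ_ : {A : Set} → (A → Bool) → (A → Bool) → Set
P ⊆ᵇ Q = ∀ x → P x ≡ true → Q x ≡ true

not≡true⇒≡false : ∀ {b} → not b ≡ true → b ≡ false
not≡true⇒≡false {b} e = trans (≡.sym (not-involutive b)) (cong not e)

<ᵇ≡true⇒≤ : ∀ {m k} → (m <ᵇ k) ≡ true → m ≤ k
<ᵇ≡true⇒≤ {m} {k} e = <⇒≤ (<ᵇ⇒< m k (Equivalence.from T-≡ e))

<ᵇ≡false⇒≥ : ∀ {m k} → (m <ᵇ k) ≡ false → k ≤ m
<ᵇ≡false⇒≥ e = ≮⇒≥ λ m<k → subst T e (<⇒<ᵇ m<k)

count : {A : Set} → (A → Bool) → List A → ℕ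
count P xs = length (filterᵇ P xs)

module _ {A : Set} where

  count-mono : {P Q : A → Bool} → P ⊆ᵇ Q → ∀ xs → count P xs ≤ count Q xs
  count-mono P⊆Q [] = z≤n
  count-mono {P} {Q} P⊆Q (x ∷ xs) with P x in p | Q x in q
  ... | true  | true  = s≤s (count-mono P⊆Q xs)
  ... | true  | false = contradiction (trans (≡.sym (P⊆Q x p)) q) λ ()
  ... | false | true  = m≤n⇒m≤1+n (count-mono P⊆Q xs)
  ... | false | false = count-mono P⊆Q xs

  count-disjoint : {P Q R : A → Bool} → P ⊆ᵇ R → Q ⊆ᵇ R → (∀ x → P x ≡ true → Q x ≡ false) →
    ∀ xs → count P xs + count Q xs ≤ count R xs
  count-disjoint P⊆R Q⊆R disjoint [] = z≤n
  count-disjoint {P} {Q} {R} P⊆R Q⊆R disjoint (x ∷ xs) with P x in p | Q x in q | R x in r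
  ... | false | false | false = count-disjoint P⊆R Q⊆R disjoint xs
  ... | false | false | true  = m≤n⇒m≤1+n (count-disjoint P⊆R Q⊆R disjoint xs)
  ... | true  | false | true  = s≤s (count-disjoint P⊆R Q⊆R disjoint xs)
  ... | false | true  | true  =
    subst (_≤ suc (count R xs)) (≡.sym (+-suc (count P xs) (count Q xs)))
          (s≤s (count-disjoint P⊆R Q⊆R disjoint xs))
  ... | true  | true  | _     = contradiction (trans (≡.sym q) (disjoint x p)) λ ()
  ... | true  | false | false = contradiction (trans (≡.sym (P⊆R x p)) r) λ ()
  ... | false | true  | false = contradiction (trans (≡.sym (Q⊆R x q)) r) λ ()

  count-none : {P : A → Bool} → (∀ x → P x ≡ false) → ∀ xs → count P xs ≡ 0
  count-none none [] = refl
  count-none none (x ∷ xs) rewrite none x = count-none none xs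

module _ {n : ℕ} (G : Graph n) where

  size : VSet n → ℕ
  size C = count C (allFin n)

  size≤n : ∀ C → size C ≤ n
  size≤n C = subst (size C ≤_) (length-tabulate id) (length-filter (T? ∘ C) (allFin n))

  deg-mono : ∀ {C D} → C ⊆ᵇ D → ∀ w → deg G C w ≤ deg G D w
  deg-mono {C} {D} C⊆D w = count-mono restrict (allFin n)
    where
    restrict : ∀ u → C u ∧ adj G w u ≡ true → D u ∧ adj G w u ≡ true
    restrict u e = cong₂ _∧_ (C⊆D u (∧-conicalˡ _ _ e)) (∧-conicalʳ (C u) _ e)

  deg-independent : ∀ {I} → IsIndependent G I → ∀ {w} → I w ≡ true → deg G I w ≡ 0
  deg-independent {I} independent {w} Iw = count-none no-neighbour (allFin n)
    where
    no-neighbour : ∀ u → I u ∧ adj G w u ≡ false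
    no-neighbour u with I u in Iu
    ... | true  = independent w u Iw Iu
    ... | false = refl

  size+deg≤size : ∀ {C C'} v → C' ⊆ᵇ C → (∀ u → C' u ≡ true → adj G v u ≡ false) →
    size C' + deg G C v ≤ size C
  size+deg≤size {C} {C'} v C'⊆C avoids-v =
    count-disjoint C'⊆C (λ u → ∧-conicalˡ _ _) disjoint (allFin n)
    where
    disjoint : ∀ u → C' u ≡ true → C u ∧ adj G v u ≡ false
    disjoint u e = trans (cong (C u ∧_) (avoids-v u e)) (∧-zeroʳ (C u))

  maxDeg≤ : ∀ {C D} → (∀ w → C w ≡ true → deg G C w ≤ D) → maxDeg G C ≤ D
  maxDeg≤ {C} {D} bounded = go (allFin n)
    where
    entry : ∀ w → (if C w then deg G C w else 0) ≤ D
    entry w with C w in Cw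
    ... | true  = bounded w Cw
    ... | false = z≤n
    go : ∀ xs → foldr (λ w m → (if C w then deg G C w else 0) ⊔ m) 0 xs ≤ D
    go []       = z≤n
    go (x ∷ xs) = ⊔-lub (entry x) (go xs)

foldl-step : {A B : Set} {f : B → A → B} {z : B} {xs : List A} {r : B} → foldl f z xs ≡ r → B → A → B
foldl-step {f = f} _ = f

module _ {n : ℕ} (G : Graph n) (cand : VSet n) (d : Fin n → ℕ) where

  -- The step function of argmax is local to its where block; unification recovers it.
  argmaxStep : Maybe (Fin n) → Fin n → Maybe (Fin n)
  argmaxStep = foldl-step {z = nothing} {xs = allFin n} (refl {x = argmax G cand d})

  IsCandidate : Fin n → Set
  IsCandidate a = cand a ≡ true

  score : Maybe (Fin n) → ℕ
  score = maybe′ d 0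

  argmaxStep-candidate : ∀ {acc} x → All IsCandidate acc → All IsCandidate (argmaxStep acc x)
  argmaxStep-candidate x c with cand x in cx
  argmaxStep-candidate x c | false = c
  argmaxStep-candidate {nothing} x c | true = just cx
  argmaxStep-candidate {just u} x c | true with d u <ᵇ d x
  ... | true  = just cx
  ... | false = c

  argmaxStep-score-mono : ∀ acc x → score acc ≤ score (argmaxStep acc x)
  argmaxStep-score-mono acc x with cand x
  argmaxStep-score-mono acc      x | false = ≤-refl
  argmaxStep-score-mono nothing  x | true  = z≤n
  argmaxStep-score-mono (just u) x | true with d u <ᵇ d x in lt
  ... | true  = <ᵇ≡true⇒≤ lt
  ... | false = ≤-refl

  argmaxStep-covers : ∀ acc x → cand x ≡ true → d x ≤ score (argmaxStep acc x)
  argmaxStep-covers acc x cx rewrite cx with acc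
  ... | nothing = ≤-refl
  ... | just u with d u <ᵇ d x in lt
  ...   | true  = ≤-refl
  ...   | false = <ᵇ≡false⇒≥ lt

  foldl-candidate : ∀ xs {acc} → All IsCandidate acc → All IsCandidate (foldl argmaxStep acc xs)
  foldl-candidate []       c = c
  foldl-candidate (x ∷ xs) c = foldl-candidate xs (argmaxStep-candidate x c)

  foldl-score-mono : ∀ xs acc → score acc ≤ score (foldl argmaxStep acc xs)
  foldl-score-mono []       acc = ≤-refl
  foldl-score-mono (x ∷ xs) acc = ≤-trans (argmaxStep-score-mono acc x) (foldl-score-mono xs _)

  foldl-covers : ∀ xs acc {u} → u ∈ xs → cand u ≡ true → d u ≤ score (foldl argmaxStep acc xs)
  foldl-covers (x ∷ xs) acc (here refl) cu = ≤-trans (argmaxStep-covers acc x cu) (foldl-score-mono xs _)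
  foldl-covers (x ∷ xs) acc (there u∈xs) cu = foldl-covers xs _ u∈xs cu

  argmax-spec : ∀ {v} → argmax G cand d ≡ just v → cand v ≡ true × (∀ u → cand u ≡ true → d u ≤ d v)
  argmax-spec picked =
    drop-just (subst (All IsCandidate) picked (foldl-candidate (allFin n) nothing)) ,
    λ u cu → subst (λ r → d u ≤ score r) picked (foldl-covers (allFin n) nothing (∈-allFin u) cu)

suc-*-+ : ∀ t x y → suc t * x + y ≡ t * x + (y + x)
suc-*-+ = solve-∀

budget-step : ∀ {t Δ Δ′ s s′ n} → t * Δ + s ≤ n → Δ′ ≤ Δ → s′ + Δ′ ≤ s → suc t * Δ′ + s′ ≤ n
budget-step {t} {Δ} {Δ′} {s} {s′} {n} budget Δ′≤Δ s′+Δ′≤s = begin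
  suc t * Δ′ + s′    ≡⟨ suc-*-+ t Δ′ s′ ⟩
  t * Δ′ + (s′ + Δ′) ≤⟨ +-mono-≤ (*-monoʳ-≤ t Δ′≤Δ) s′+Δ′≤s ⟩
  t * Δ + s          ≤⟨ budget ⟩
  n                  ∎
  where open ≤-Reasoning

module _ {n : ℕ} (G : Graph n) (I : VSet n) (independent : IsIndependent G I) where

  Candidates : VSet n → VSet n
  Candidates F v = I v ∧ not (F v)

  record Invariant (t : ℕ) (F C : VSet n) : Set where
    field
      Δ : ℕ
      budget : t * Δ + size G C ≤ n
      member-deg≤ : ∀ w → C w ≡ true → deg G C w ≤ Δ
      candidate-deg≤ : ∀ v → Candidates F v ≡ true → deg G C v ≤ Δ

  Candidates-antitone : ∀ {F F′} → F ⊆ᵇ F′ → Candidates F′ ⊆ᵇ Candidates F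
  Candidates-antitone {F} {F′} F⊆F′ v e with F v in Fv
  ... | false = trans (∧-identityʳ (I v)) (∧-conicalˡ _ _ e)
  ... | true  = contradiction (trans (≡.sym e) F′-excludes-v) λ ()
    where
    F′-excludes-v : I v ∧ not (F′ v) ≡ false
    F′-excludes-v = trans (cong (λ b → I v ∧ not b) (F⊆F′ v Fv)) (∧-zeroʳ (I v))

  pruned : VSet n → Fin n → VSet n
  pruned C v w = C w ∧ not (adj G v w) ∧ not (deg G C v <ᵇ deg G C w)

  module _ (C : VSet n) (v : Fin n) where

    pruned⊆ : pruned C v ⊆ᵇ C
    pruned⊆ w kept = ∧-conicalˡ _ _ kept

    pruned-non-adjacent : ∀ w → pruned C v w ≡ true → adj G v w ≡ false
    pruned-non-adjacent w kept = not≡true⇒≡false (∧-conicalˡ _ _ (∧-conicalʳ (C w) _ kept))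

    pruned-deg≤ : ∀ w → pruned C v w ≡ true → deg G C w ≤ deg G C v
    pruned-deg≤ w kept =
      <ᵇ≡false⇒≥ (not≡true⇒≡false (∧-conicalʳ (not (adj G v w)) _ (∧-conicalʳ (C w) _ kept)))

  invariant-start : Invariant 0 (λ _ → false) (λ _ → true)
  invariant-start = record
    { Δ = n
    ; budget = size≤n G (λ _ → true)
    ; member-deg≤ = λ w _ → size≤n G _
    ; candidate-deg≤ = λ v _ → size≤n G _
    }

  invariant-exhausted : ∀ {t} → Invariant (suc t) I I
  invariant-exhausted {t} = record
    { Δ = 0
    ; budget = subst (λ k → k + size G I ≤ n) (≡.sym (*-zeroʳ (suc t))) (size≤n G I)
    ; member-deg≤ = λ w Iw → ≤-reflexive (deg-independent G independent Iw)
    ; candidate-deg≤ = λ v e → contradiction (trans (≡.sym e) (∧-inverseʳ (I v))) λ ()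
    }

  invariant-pick : ∀ {t F F′ C v} → Invariant t F C → F ⊆ᵇ F′ →
    Candidates F v ≡ true → (∀ u → Candidates F u ≡ true → deg G C u ≤ deg G C v) →
    Invariant (suc t) F′ (pruned C v)
  invariant-pick {t} {C = C} {v = v} inv F⊆F′ v-candidate v-max = record
    { Δ = deg G C v
    ; budget = budget-step {t} budget (candidate-deg≤ v v-candidate)
                 (size+deg≤size G v (pruned⊆ C v) (pruned-non-adjacent C v))
    ; member-deg≤ = λ w kept → ≤-trans (deg-mono G (pruned⊆ C v) w) (pruned-deg≤ C v w kept)
    ; candidate-deg≤ = λ u e →
        ≤-trans (deg-mono G (pruned⊆ C v) u) (v-max u (Candidates-antitone F⊆F′ u e))
    }
    where open Invariant inv

  invariant-step : ∀ {t F C} → Invariant t F C →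
    Invariant (suc t) (proj₁ (step G I (F , C))) (proj₂ (step G I (F , C)))
  invariant-step {F = F} {C} inv with argmax G (Candidates F) (deg G C) in picked
  ... | nothing = invariant-exhausted
  ... | just v  with argmax-spec G (Candidates F) (deg G C) picked
  ...   | v-candidate , v-max = invariant-pick inv (λ w e → cong (_∨ _) e) v-candidate v-max

  invariant-run : ∀ t → Invariant t (proj₁ (run G I t)) (container G I t)
  invariant-run zero    = invariant-start
  invariant-run (suc t) = invariant-step (invariant-run t)

proposition2 : (n : ℕ) (G : Graph n) (I : VSet n) → IsIndependent G I →
    (t : ℕ) → 1 ≤ t → t * maxDeg G (container G I t) ≤ n
proposition2 n G I independent t _ = begin
  t * maxDeg G (container G I t)   ≤⟨ *-monoʳ-≤ t (maxDeg≤ G member-deg≤) ⟩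
  t * Δ                            ≤⟨ m≤m+n (t * Δ) _ ⟩
  t * Δ + size G (container G I t) ≤⟨ budget ⟩
  n                                ∎
  where
  open ≤-Reasoning
  open Invariant (invariant-run G I independent t)
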